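{- For all $m\ge2$: (1) $\mathcal{Q}_1^{m+1}=\varepsilon(\mathcal{Q}_3^m\cup\mathcal{Q}_4^m)$; (2) $\mathcal{Q}_2^{m+1}=\delta(\mathcal{Q}_1^m\cup\mathcal{Q}_2^m)$; (3) $\mathcal{Q}_3^{m+1}=\delta(\mathcal{Q}_3^m\cup\mathcal{Q}_4^m)$; (4) $\mathcal{Q}_4^{m+1}=\varepsilon(\mathcal{Q}_1^m\cup\mathcal{Q}_2^m)$.
   Context: The Thue-Morse substitution is $\theta(0)=01$, $\theta(1)=10$. For $m\ge2$, $\mathcal{A}_m$ is the set of subwords of length $2^m+1$ of the Thue-Morse sequence $0110100110010110\dots$; it has $3\cdot2^m$ elements, listed in lexicographic order (with $0<1$) as $w^m_1<\dots<w^m_{|\mathcal{A}_m|}$. It is partitioned into four blocks of consecutive words of equal size: $\mathcal{Q}^m_k=\{w^m_j:(k-1)\tfrac14|\mathcal{A}_m|<j\le k\tfrac14|\mathcal{A}_m|\}$, $k=1,2,3,4$. For $u\in\mathcal{A}_m$, $\delta(u)$ is the prefix of length $2^{m+1}+1$ and $\varepsilon(u)$ the suffix of length $2^{m+1}+1$ of $\theta(u)$ (a word of length $2^{m+1}+2$); these maps are applied elementwise to sets. -}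

module Defs where

open import Data.Bool using (Bool; true; false; not)
open import Data.Nat using (ℕ; zero; suc; _+_; _*_; _∸_; _^_; _≤_; _<_)
open import Data.List using (List; []; _∷_; _++_; length; lookup; take; drop; concatMap)
open import Data.List.Membership.Propositional using (_∈_)
open import Data.List.Relation.Unary.Linked using (Linked)
open import Data.List.Relation.Binary.Infix.Heterogeneous using (Infix)
open import Data.Fin using (Fin; toℕ)
open import Data.Product using (Σ; ∃; _×_; _,_)
open import Data.Sum using (_⊎_)
open import Relation.Binary.PropositionalEquality using (_≡_)
open import Function.Bundles using (_⇔_)

-- Words over {0,1}; the letter 0 is false, 1 is true.
Word : Set
Word = List Bool

θ₁ : Bool → Word
θ₁ false = false ∷ true ∷ []
θ₁ true  = true ∷ false ∷ []

θ : Word → Word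
θ = concatMap θ₁

tmPrefix : ℕ → Word
tmPrefix zero    = false ∷ []
tmPrefix (suc n) = θ (tmPrefix n)

IsFactor : Word → Set
IsFactor w = ∃ λ n → Infix _≡_ w (tmPrefix n)

InA : ℕ → Word → Set
InA m w = length w ≡ 2 ^ m + 1 × IsFactor w

-- Strict lexicographic order with 0 < 1 (used on words of equal length).
data _<ˡ_ : Word → Word → Set where
  here : ∀ {xs ys} → (false ∷ xs) <ˡ (true ∷ ys)
  there : ∀ {x xs ys} → xs <ˡ ys → (x ∷ xs) <ˡ (x ∷ ys)

Enumerates : ℕ → List Word → Set
Enumerates m l = Linked _<ˡ_ l × (∀ w → (w ∈ l) ⇔ InA m w)

-- w ∈ 𝒬^m_k : w = w^m_{j+1} (0-based index j) with
-- (k-1)·N/4 < j+1 ≤ k·N/4, N = |𝒜_m|, i.e. (k-1)·N < 4(j+1) ≤ k·N.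
InQ : ℕ → ℕ → Word → Set
InQ m k w =
  Σ (List Word) λ l → Enumerates m l ×
    Σ (Fin (length l)) λ j →
      lookup l j ≡ w ×
      (k ∸ 1) * length l < 4 * suc (toℕ j) ×
      4 * suc (toℕ j) ≤ k * length l

-- δ(u): prefix of length 2^(m+1)+1 of θ(u);  ε(u): suffix of length 2^(m+1)+1 of θ(u)
-- (θ(u) has length 2^(m+1)+2 for u ∈ 𝒜_m, so ε drops its first letter).
δ : ℕ → Word → Word
δ m u = take (2 ^ (suc m) + 1) (θ u)

ε : ℕ → Word → Word
ε m u = drop (length (θ u) ∸ (2 ^ (suc m) + 1)) (θ u)

ImageUnion : (Word → Word) → (Word → Set) → (Word → Set) → Word → Set
ImageUnion f P Q w = ∃ λ u → (P u ⊎ Q u) × f u ≡ w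

_≐_ : (Word → Set) → (Word → Set) → Set
P ≐ Q = ∀ w → P w ⇔ Q w

module Submission where

-- Write initθ u and tailθ u for θ(u) with its last, resp. first, letter removed;
-- on 𝒜_m they coincide with δ and ε.  For m ≥ 1 split the increasing list of 𝒜_m
-- into the words starting with 0 (the "low" half L_m) and those starting with 1
-- (the "high" half H_m).  The heart of the proof is that the increasing list of
-- 𝒜_{m+1} is the concatenation of four blocks of equal length
--     tailθ(H_m) ++ initθ(L_m) ++ initθ(H_m) ++ tailθ(L_m),
-- so that L_{m+1} = tailθ(H_m) ++ initθ(L_m) and H_{m+1} = initθ(H_m) ++ tailθ(L_m).
-- This is an induction from m = 1 using
--   * desubstitution: every factor of odd length 2n+1 ≥ 3 is initθ u or tailθ u for
--     a factor u of length n+1, so the four blocks exhaust 𝒜_{m+1};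
--   * monotonicity of θ, initθ and (on words with equal first letter) tailθ for the
--     lexicographic order, and comparisons between blocks, which only need that
--     000 and 111 are not factors.
-- Since a strictly increasing enumeration is unique, the quarters 𝒬^{m+1}_k are the
-- four blocks; for m ≥ 2 the same holds one level down, so 𝒬^m_1 ∪ 𝒬^m_2 = L_m and
-- 𝒬^m_3 ∪ 𝒬^m_4 = H_m, and the four identities follow by taking images.

open import Defs
open import Data.Bool using (Bool; true; false; not)
open import Data.Bool.Properties using (not-¬)
open import Data.Empty using (⊥-elim)
open import Data.Fin using (Fin; toℕ; zero; suc)
open import Data.Nat using (ℕ; zero; suc; _+_; _*_; _∸_; _^_; _≤_; _<_; z≤n; s≤s; s≤s⁻¹)
open import Data.Nat.Properties
  using (+-comm; +-suc; +-identityʳ; *-assoc; *-comm; suc-injective; m^n>0; m+n∸n≡m;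
         *-cancelˡ-<; *-cancelˡ-≤; *-monoʳ-<; *-monoʳ-≤)
open import Data.List using (List; []; _∷_; _++_; length; lookup; take; drop; map)
open import Data.List.Properties using (length-++; length-map; ++-assoc; ++-identityʳ; ∷-injective)
open import Data.List.Membership.Propositional using (_∈_)
open import Data.List.Membership.Propositional.Properties
  using (∈-map⁺; ∈-map⁻; ∈-++⁺ˡ; ∈-++⁺ʳ; ∈-++⁻; ++-∈⇔)
open import Data.List.Relation.Binary.Infix.Heterogeneous using (Infix; MkView; toView; fromView)
open import Data.List.Relation.Binary.Infix.Heterogeneous.Properties using (length-mono)
open import Data.List.Relation.Binary.Pointwise using (Pointwise-≡⇒≡; ≡⇒Pointwise-≡)
open import Data.List.Relation.Unary.Any using (here; there)
open import Data.List.Relation.Unary.All as All using (All; []; _∷_)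
import Data.List.Relation.Unary.All.Properties as All
open import Data.List.Relation.Unary.AllPairs as AllPairs using (AllPairs; []; _∷_)
import Data.List.Relation.Unary.AllPairs.Properties as AllPairs
open import Data.List.Relation.Unary.Linked.Properties using (AllPairs⇒Linked; Linked⇒AllPairs)
open import Data.Product using (Σ; ∃; ∃₂; _×_; _,_; proj₁; proj₂)
open import Data.Sum using (_⊎_; inj₁; inj₂)
open import Data.Sum.Function.Propositional using (_⊎-⇔_)
open import Data.Unit using (tt)
open import Function.Bundles using (_⇔_; mk⇔; Equivalence)
open import Function.Properties.Equivalence using () renaming (trans to ⇔-trans; sym to ⇔-sym)
open import Relation.Nullary using (¬_; Dec; yes; no)
open import Relation.Nullary.Decidable using (map′; toWitness)
open import Relation.Binary.PropositionalEquality
  using (_≡_; refl; sym; trans; cong; cong₂; subst; subst₂; module ≡-Reasoning)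

-- double n = 2n, by the recursion that mirrors θ (two letters for each letter).
double : ℕ → ℕ
double zero    = zero
double (suc n) = suc (suc (double n))

θ-∷ : ∀ a r → θ (a ∷ r) ≡ a ∷ not a ∷ θ r
θ-∷ false r = refl
θ-∷ true  r = refl

θ-++ : ∀ xs ys → θ (xs ++ ys) ≡ θ xs ++ θ ys
θ-++ []       ys = refl
θ-++ (x ∷ xs) ys = trans (cong (θ₁ x ++_) (θ-++ xs ys)) (sym (++-assoc (θ₁ x) (θ xs) (θ ys)))

length-θ : ∀ r → length (θ r) ≡ double (length r)
length-θ []      = refl
length-θ (a ∷ r) = trans (cong length (θ-∷ a r)) (cong (λ n → suc (suc n)) (length-θ r))

StartsWith : Bool → Word → Set
StartsWith b w = ∃ λ r → w ≡ b ∷ r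

initθ : Word → Word
initθ []          = []
initθ (a ∷ [])    = a ∷ []
initθ (a ∷ b ∷ r) = a ∷ not a ∷ initθ (b ∷ r)

tailθ : Word → Word
tailθ []      = []
tailθ (a ∷ r) = not a ∷ θ r

length-initθ : ∀ a r → length (initθ (a ∷ r)) ≡ suc (double (length r))
length-initθ a []      = refl
length-initθ a (b ∷ r) = cong (λ n → suc (suc n)) (length-initθ b r)

initθ-head : ∀ a r → StartsWith a (initθ (a ∷ r))
initθ-head a []      = [] , refl
initθ-head a (b ∷ r) = not a ∷ initθ (b ∷ r) , refl

length-tailθ : ∀ a r → length (tailθ (a ∷ r)) ≡ suc (double (length r))
length-tailθ a r = cong suc (length-θ r)

-- Occurrence of w in t with explicit left and right context; this is the
-- stdlib relation Infix _≡_ (the form used by IsFactor) in a usable shape.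
_⊑_ : Word → Word → Set
w ⊑ t = ∃₂ λ xs ys → t ≡ xs ++ w ++ ys

infix⇒⊑ : ∀ {w t} → Infix _≡_ w t → w ⊑ t
infix⇒⊑ i with MkView xs p ys ← toView i = xs , ys , cong (λ v → xs ++ v ++ ys) (sym (Pointwise-≡⇒≡ p))

⊑⇒infix : ∀ {w t} → w ⊑ t → Infix _≡_ w t
⊑⇒infix (xs , ys , refl) = fromView (MkView xs (≡⇒Pointwise-≡ refl) ys)

⊑-trans : ∀ {w v t} → w ⊑ v → v ⊑ t → w ⊑ t
⊑-trans {w} (as , bs , refl) (xs , ys , refl) = xs ++ as , bs ++ ys , (begin
  xs ++ (as ++ w ++ bs) ++ ys   ≡⟨ cong (xs ++_) (++-assoc as (w ++ bs) ys) ⟩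
  xs ++ as ++ (w ++ bs) ++ ys   ≡⟨ cong (λ z → xs ++ as ++ z) (++-assoc w bs ys) ⟩
  xs ++ as ++ w ++ bs ++ ys     ≡⟨ sym (++-assoc xs as (w ++ bs ++ ys)) ⟩
  (xs ++ as) ++ w ++ bs ++ ys   ∎)
  where open ≡-Reasoning

⊑-θ : ∀ {w t} → w ⊑ t → θ w ⊑ θ t
⊑-θ {w} (xs , ys , refl) = θ xs , θ ys , trans (θ-++ xs (w ++ ys)) (cong (θ xs ++_) (θ-++ w ys))

factor-θ : ∀ {u} → IsFactor u → IsFactor (θ u)
factor-θ (n , i) = suc n , ⊑⇒infix (⊑-θ (infix⇒⊑ i))

factor-⊑ : ∀ {w v} → w ⊑ v → IsFactor v → IsFactor w
factor-⊑ p (n , i) = n , ⊑⇒infix (⊑-trans p (infix⇒⊑ i))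

factor-initθ : ∀ {u} → IsFactor u → IsFactor (initθ u)
factor-initθ {u} f = factor-⊑ ([] , prefix u .proj₁ , prefix u .proj₂) (factor-θ f)
  where
  prefix : ∀ u → ∃ λ s → θ u ≡ initθ u ++ s
  prefix []          = [] , refl
  prefix (a ∷ [])    = not a ∷ [] , θ-∷ a []
  prefix (a ∷ b ∷ r) = prefix (b ∷ r) .proj₁ ,
    trans (θ-∷ a (b ∷ r)) (cong (λ z → a ∷ not a ∷ z) (prefix (b ∷ r) .proj₂))

factor-tailθ : ∀ {u} → IsFactor u → IsFactor (tailθ u)
factor-tailθ {[]}    f = f
factor-tailθ {a ∷ r} f = factor-⊑ (a ∷ [] , [] , suffix) (factor-θ f)
  where
  suffix : θ (a ∷ r) ≡ a ∷ tailθ (a ∷ r) ++ []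
  suffix = trans (θ-∷ a r) (cong (λ z → a ∷ not a ∷ z) (sym (++-identityʳ (θ r))))

θ-prefix-even : ∀ k t w ys → length w ≡ double k → θ t ≡ w ++ ys →
                ∃₂ λ u q → t ≡ u ++ q × length u ≡ k × θ u ≡ w
θ-prefix-even zero    t       []          ys _ _ = [] , t , refl , refl , refl
θ-prefix-even (suc k) []      (c ∷ d ∷ w) ys l ()
θ-prefix-even (suc k) (a ∷ t) (c ∷ d ∷ w) ys l e
  with a≡c , e′ ← ∷-injective (trans (sym (θ-∷ a t)) e)
  with na≡d , θt ← ∷-injective e′
  with u , q , t≡ , lu , θu ← θ-prefix-even k t w ys (suc-injective (suc-injective l)) θt
  = a ∷ u , q , cong (a ∷_) t≡ , cong suc lu , trans (θ-∷ a u) (cong₂ _∷_ a≡c (cong₂ _∷_ na≡d θu))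

θ-prefix-odd : ∀ k t w ys → length w ≡ suc (double k) → θ t ≡ w ++ ys →
               ∃₂ λ u q → t ≡ u ++ q × length u ≡ suc k × initθ u ≡ w
θ-prefix-odd k       []      (c ∷ w)     ys l ()
θ-prefix-odd zero    (a ∷ t) (c ∷ [])    ys l e
  with a≡c , _ ← ∷-injective (trans (sym (θ-∷ a t)) e)
  = a ∷ [] , t , refl , refl , cong (_∷ []) a≡c
θ-prefix-odd (suc k) (a ∷ t) (c ∷ d ∷ w) ys l e
  with a≡c , e′ ← ∷-injective (trans (sym (θ-∷ a t)) e)
  with na≡d , θt ← ∷-injective e′
  with b ∷ u , q , t≡ , lu , δu ← θ-prefix-odd k t w ys (suc-injective (suc-injective l)) θt
  = a ∷ b ∷ u , q , cong (a ∷_) t≡ , cong suc lu , cong₂ _∷_ a≡c (cong₂ _∷_ na≡d δu)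

-- A factor of θ t of odd length 2k+1 is initθ u (if it starts at an even position)
-- or tailθ u (if it starts at an odd position) for a factor u of t of length k+1.
θ-factor-odd : ∀ k xs t w ys → length w ≡ suc (double k) → θ t ≡ xs ++ w ++ ys →
               ∃ λ u → u ⊑ t × length u ≡ suc k × (w ≡ initθ u ⊎ w ≡ tailθ u)
θ-factor-odd k [] t w ys l e
  with u , q , t≡ , lu , δu ← θ-prefix-odd k t w ys l e
  = u , ([] , q , t≡) , lu , inj₁ (sym δu)
θ-factor-odd k (x ∷ []) [] w ys l ()
θ-factor-odd k (x ∷ []) (a ∷ t) (c ∷ w) ys l e
  with _ , e′ ← ∷-injective (trans (sym (θ-∷ a t)) e)
  with na≡c , θt ← ∷-injective e′
  with u , q , t≡ , lu , θu ← θ-prefix-even k t w ys (suc-injective l) θt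
  = a ∷ u , ([] , q , cong (a ∷_) t≡) , cong suc lu , inj₂ (cong₂ _∷_ (sym na≡c) (sym θu))
θ-factor-odd k (x ∷ y ∷ xs) [] w ys l ()
θ-factor-odd k (x ∷ y ∷ xs) (a ∷ t) w ys l e
  with _ , e′ ← ∷-injective (trans (sym (θ-∷ a t)) e)
  with _ , θt ← ∷-injective e′
  with u , (p , q , t≡) , lu , r ← θ-factor-odd k xs t w ys l θt
  = u , (a ∷ p , q , cong (a ∷_) t≡) , lu , r

factor-desubstitution : ∀ k w → IsFactor w → length w ≡ suc (double (suc k)) →
  ∃ λ u → IsFactor u × length u ≡ suc (suc k) × (w ≡ initθ u ⊎ w ≡ tailθ u)
factor-desubstitution k w (zero , i) l with s≤s () ← subst (_≤ 1) l (length-mono i)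
factor-desubstitution k w (suc n , i) l
  with xs , ys , e ← infix⇒⊑ i
  with u , u⊑ , lu , r ← θ-factor-odd (suc k) xs (tmPrefix n) w ys l e
  = u , (n , ⊑⇒infix u⊑) , lu , r

no-flip : ∀ {c a : Bool} {v w : Word} → ¬ (c ∷ c ∷ v ≡ a ∷ not a ∷ w)
no-flip {c} e with c≡a , e′ ← ∷-injective e = not-¬ c≡a (proj₁ (∷-injective e′))

no-cube : ∀ c → ¬ IsFactor (c ∷ c ∷ c ∷ [])
no-cube c f with factor-desubstitution 0 _ f refl
... | a ∷ b ∷ [] , _ , refl , inj₁ e = no-flip e
... | a ∷ b ∷ [] , _ , refl , inj₂ e = no-flip (cong (drop 1) (trans e (cong (not a ∷_) (θ-∷ b []))))

<ˡ-trans : ∀ {x y z} → x <ˡ y → y <ˡ z → x <ˡ z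
<ˡ-trans here      (there _) = here
<ˡ-trans (there p) here      = here
<ˡ-trans (there p) (there q) = there (<ˡ-trans p q)

<ˡ-irrefl : ∀ {x} → ¬ (x <ˡ x)
<ˡ-irrefl (there p) = <ˡ-irrefl p

_<ˡ?_ : ∀ x y → Dec (x <ˡ y)
[]          <ˡ? y           = no λ ()
(a ∷ x)     <ˡ? []          = no λ ()
(false ∷ x) <ˡ? (true ∷ y)  = yes here
(true ∷ x)  <ˡ? (false ∷ y) = no λ ()
(false ∷ x) <ˡ? (false ∷ y) = map′ there (λ { (there p) → p }) (x <ˡ? y)
(true ∷ x)  <ˡ? (true ∷ y)  = map′ there (λ { (there p) → p }) (x <ˡ? y)

θ-mono : ∀ {u v} → u <ˡ v → θ u <ˡ θ v
θ-mono here              = here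
θ-mono (there {false} p) = there (there (θ-mono p))
θ-mono (there {true} p)  = there (there (θ-mono p))

initθ-mono : ∀ {u v} → u <ˡ v → initθ u <ˡ initθ v
initθ-mono (here {[]}    {[]})    = here
initθ-mono (here {[]}    {_ ∷ _}) = here
initθ-mono (here {_ ∷ _} {[]})    = here
initθ-mono (here {_ ∷ _} {_ ∷ _}) = here
initθ-mono (there p@here)         = there (there (initθ-mono p))
initθ-mono (there p@(there _))    = there (there (initθ-mono p))

tailθ-mono : ∀ {a r s} → (a ∷ r) <ˡ (a ∷ s) → tailθ (a ∷ r) <ˡ tailθ (a ∷ s)
tailθ-mono (there p) = there (θ-mono p)

prefix-factor : ∀ {a b c r} → IsFactor (a ∷ b ∷ c ∷ r) → IsFactor (a ∷ b ∷ c ∷ [])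
prefix-factor {r = r} = factor-⊑ ([] , r , refl)

-- The two words share their first letter; only the cube bbb
-- in u could reverse the order.
tailθ-high<initθ-low : ∀ b c r d e s → IsFactor (true ∷ b ∷ c ∷ r) →
                       tailθ (true ∷ b ∷ c ∷ r) <ˡ initθ (false ∷ d ∷ e ∷ s)
tailθ-high<initθ-low false c     r d     e s f = there here
tailθ-high<initθ-low true  c     r true  e s f = there (there here)
tailθ-high<initθ-low true  false r false e s f = there (there (there here))
tailθ-high<initθ-low true  true  r false e s f = ⊥-elim (no-cube true (prefix-factor f))

initθ-high<tailθ-low : ∀ b c r d e s → IsFactor (false ∷ b ∷ c ∷ r) →
                       initθ (true ∷ d ∷ e ∷ s) <ˡ tailθ (false ∷ b ∷ c ∷ r)
initθ-high<tailθ-low true  c     r d     e s f = there here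
initθ-high<tailθ-low false c     r false e s f = there (there here)
initθ-high<tailθ-low false true  r true  e s f = there (there (there here))
initθ-high<tailθ-low false false r true  e s f = ⊥-elim (no-cube false (prefix-factor f))

module _ {A : Set} {_≺_ : A → A → Set}
         (≺-trans : ∀ {x y z} → x ≺ y → y ≺ z → x ≺ z) (≺-irrefl : ∀ {x} → ¬ (x ≺ x)) where

  sorted-unique : ∀ {xs ys : List A} → AllPairs _≺_ xs → AllPairs _≺_ ys →
                  (∀ {w} → w ∈ xs → w ∈ ys) → (∀ {w} → w ∈ ys → w ∈ xs) → xs ≡ ys
  sorted-unique {[]}     {[]}     _ _ _ _ = refl
  sorted-unique {[]}     {y ∷ ys} _ _ _ g with () ← g (here refl)
  sorted-unique {x ∷ xs} {[]}     _ _ f _ with () ← f (here refl)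
  sorted-unique {x ∷ xs} {y ∷ ys} (x≺xs ∷ sxs) (y≺ys ∷ sys) f g =
    cong₂ _∷_ x≡y (sorted-unique sxs sys (drop-head x≺xs f x≡y) (drop-head y≺ys g (sym x≡y)))
    where
    x≡y : x ≡ y
    x≡y with f (here refl) | g (here refl)
    ... | here e    | _         = e
    ... | there _   | here e    = sym e
    ... | there x∈ | there y∈ = ⊥-elim (≺-irrefl (≺-trans (All.lookup x≺xs y∈) (All.lookup y≺ys x∈)))

    -- Removing equal heads preserves inclusion, since the head is below the tail.
    drop-head : ∀ {a b as bs} → All (a ≺_) as → (∀ {w} → w ∈ a ∷ as → w ∈ b ∷ bs) → a ≡ b →
                ∀ {w} → w ∈ as → w ∈ bs
    drop-head a≺as h a≡b w∈ with h (there w∈)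
    ... | here refl = ⊥-elim (≺-irrefl (subst (_ ≺_) (sym a≡b) (All.lookup a≺as w∈)))
    ... | there w∈′ = w∈′

double≡2* : ∀ n → double n ≡ 2 * n
double≡2* zero    = refl
double≡2* (suc n) = cong suc (trans (cong suc (double≡2* n)) (sym (+-suc n (n + 0))))

-- Powers of 2 are positive, in the form needed to pattern match on them.
2^-suc : ∀ m → ∃ λ p → 2 ^ m ≡ suc p
2^-suc m with 2 ^ m | m^n>0 2 m
... | suc p | _ = p , refl

length-𝒜 : ∀ m {u} → InA m u → length u ≡ suc (2 ^ m)
length-𝒜 m (l , _) = trans l (+-comm (2 ^ m) 1)

length-𝒜-suc : ∀ m → 2 ^ suc m + 1 ≡ suc (double (2 ^ m))
length-𝒜-suc m = trans (+-comm (2 ^ suc m) 1) (cong suc (sym (double≡2* (2 ^ m))))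

𝒜-shape : ∀ k {u} → InA (suc k) u → ∃₂ λ a b → ∃₂ λ c r → u ≡ a ∷ b ∷ c ∷ r
𝒜-shape k {u} inA with p , 2^k≡ ← 2^-suc k = three u (begin
  length u                     ≡⟨ proj₁ inA ⟩
  2 ^ suc k + 1                ≡⟨ length-𝒜-suc k ⟩
  suc (double (2 ^ k))         ≡⟨ cong (λ n → suc (double n)) 2^k≡ ⟩
  suc (suc (suc (double p)))   ∎)
  where
  open ≡-Reasoning
  three : ∀ u {n} → length u ≡ suc (suc (suc n)) → ∃₂ λ a b → ∃₂ λ c r → u ≡ a ∷ b ∷ c ∷ r
  three (a ∷ b ∷ c ∷ r) _ = a , b , c , r , refl

𝒜-initθ-tailθ : ∀ m {u} → InA m u → InA (suc m) (initθ u) × InA (suc m) (tailθ u)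
𝒜-initθ-tailθ m {[]} inA with () ← length-𝒜 m inA
𝒜-initθ-tailθ m {a ∷ r} inA@(_ , f) =
  (trans (length-initθ a r) len , factor-initθ f) , (trans (length-tailθ a r) len , factor-tailθ f)
  where
  len : suc (double (length r)) ≡ 2 ^ suc m + 1
  len = trans (cong (λ n → suc (double n)) (suc-injective (length-𝒜 m inA))) (sym (length-𝒜-suc m))

𝒜-desubstitution : ∀ m {w} → InA (suc m) w → ∃ λ u → InA m u × (w ≡ initθ u ⊎ w ≡ tailθ u)
𝒜-desubstitution m (l , f)
  with p , 2^m≡ ← 2^-suc m
  with u , fu , lu , r ← factor-desubstitution p _ f
         (trans l (trans (length-𝒜-suc m) (cong (λ n → suc (double n)) 2^m≡)))
  = u , (trans lu (trans (cong suc (sym 2^m≡)) (+-comm 1 (2 ^ m))) , fu) , r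

δ≡initθ : ∀ m {u} → InA m u → δ m u ≡ initθ u
δ≡initθ m {[]} inA with () ← length-𝒜 m inA
δ≡initθ m {a ∷ r} inA = trans (cong (λ n → take n (θ (a ∷ r))) len) (take-initθ a r)
  where
  len : 2 ^ suc m + 1 ≡ suc (double (length r))
  len = trans (length-𝒜-suc m) (cong (λ n → suc (double n)) (sym (suc-injective (length-𝒜 m inA))))
  take-initθ : ∀ a r → take (suc (double (length r))) (θ (a ∷ r)) ≡ initθ (a ∷ r)
  take-initθ a []      = cong (take 1) (θ-∷ a [])
  take-initθ a (b ∷ r) = trans (cong (take (suc (double (length (b ∷ r))))) (θ-∷ a (b ∷ r)))
                               (cong (λ z → a ∷ not a ∷ z) (take-initθ b r))

ε≡tailθ : ∀ m {u} → InA m u → ε m u ≡ tailθ u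
ε≡tailθ m {[]} inA with () ← length-𝒜 m inA
ε≡tailθ m {a ∷ r} inA = trans (cong (λ n → drop n (θ (a ∷ r))) drops-one) (cong (drop 1) (θ-∷ a r))
  where
  open ≡-Reasoning
  ℓ : ℕ
  ℓ = suc (double (2 ^ m))
  drops-one : length (θ (a ∷ r)) ∸ (2 ^ suc m + 1) ≡ 1
  drops-one = begin
    length (θ (a ∷ r)) ∸ (2 ^ suc m + 1)   ≡⟨ cong₂ _∸_ (length-θ (a ∷ r)) (length-𝒜-suc m) ⟩
    suc (suc (double (length r))) ∸ ℓ      ≡⟨ cong (λ l → suc (suc (double l)) ∸ ℓ)
                                                   (suc-injective (length-𝒜 m inA)) ⟩
    1 + ℓ ∸ ℓ                              ≡⟨ m+n∸n≡m 1 ℓ ⟩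
    1                                      ∎

map-sorted : ∀ {A : Set} {_≺_ : A → A → Set} {P : A → Set} (f : A → A) →
             (∀ {x y} → P x → P y → x ≺ y → f x ≺ f y) →
             ∀ {xs} → All P xs → AllPairs _≺_ xs → AllPairs _≺_ (map f xs)
map-sorted f mono []         []              = []
map-sorted {_≺_ = _≺_} {P} f mono {x ∷ xs} (px ∷ pxs) (x≺xs ∷ sorted) =
  below pxs x≺xs ∷ map-sorted f mono pxs sorted
  where
  below : ∀ {ys} → All P ys → All (x ≺_) ys → All (f x ≺_) (map f ys)
  below []         []           = []
  below (py ∷ pys) (x≺y ∷ x≺ys) = mono px py x≺y ∷ below pys x≺ys

low<high : ∀ {xs ys} → All (StartsWith false) xs → All (StartsWith true) ys →
           All (λ x → All (x <ˡ_) ys) xs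
low<high sx sy = All.map (λ { (_ , refl) → All.map (λ { (_ , refl) → here }) sy }) sx

record Layer (m : ℕ) (low high : List Word) : Set where
  field
    lowSorted  : AllPairs _<ˡ_ low
    highSorted : AllPairs _<ˡ_ high
    lowStarts  : All (StartsWith false) low
    highStarts : All (StartsWith true) high
    members    : ∀ w → w ∈ low ++ high ⇔ InA m w
    balanced   : length low ≡ length high

  enumerates : Enumerates m (low ++ high)
  enumerates = AllPairs⇒Linked (AllPairs.++⁺ lowSorted highSorted (low<high lowStarts highStarts)) ,
               members

  ∈-low : ∀ {u} → u ∈ low → InA m u
  ∈-low u∈ = Equivalence.to (members _) (∈-++⁺ˡ u∈)

  ∈-high : ∀ {u} → u ∈ high → InA m u
  ∈-high u∈ = Equivalence.to (members _) (∈-++⁺ʳ low u∈)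

nextLow nextHigh : List Word → List Word → List Word
nextLow  low high = map tailθ high ++ map initθ low
nextHigh low high = map initθ high ++ map tailθ low

module LayerStep {k : ℕ} {low high : List Word} (Λ : Layer (suc k) low high) where
  open Layer Λ

  lowShape : ∀ {u} → u ∈ low → ∃₂ λ b c → ∃ λ r → u ≡ false ∷ b ∷ c ∷ r × IsFactor u
  lowShape u∈ with All.lookup lowStarts u∈ | ∈-low u∈
  ... | _ , refl | inA with _ , b , c , r , refl ← 𝒜-shape k inA = b , c , r , refl , proj₂ inA

  highShape : ∀ {u} → u ∈ high → ∃₂ λ b c → ∃ λ r → u ≡ true ∷ b ∷ c ∷ r × IsFactor u
  highShape u∈ with All.lookup highStarts u∈ | ∈-high u∈
  ... | _ , refl | inA with _ , b , c , r , refl ← 𝒜-shape k inA = b , c , r , refl , proj₂ inA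

  -- Each new half is sorted: within a block by monotonicity, across the two
  -- blocks by the cube-free comparison.
  lowSorted′ : AllPairs _<ˡ_ (nextLow low high)
  lowSorted′ = AllPairs.++⁺
    (map-sorted tailθ (λ { (_ , refl) (_ , refl) → tailθ-mono }) highStarts highSorted)
    (AllPairs.map⁺ (AllPairs.map initθ-mono lowSorted))
    (All.tabulate λ x∈ → All.tabulate λ y∈ → cross x∈ y∈)
    where
    cross : ∀ {x y} → x ∈ map tailθ high → y ∈ map initθ low → x <ˡ y
    cross x∈ y∈
      with u , u∈ , refl ← ∈-map⁻ tailθ x∈ | v , v∈ , refl ← ∈-map⁻ initθ y∈
      with b , c , r , refl , f ← highShape u∈ | d , e , s , refl , _ ← lowShape v∈
      = tailθ-high<initθ-low b c r d e s f

  highSorted′ : AllPairs _<ˡ_ (nextHigh low high)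
  highSorted′ = AllPairs.++⁺
    (AllPairs.map⁺ (AllPairs.map initθ-mono highSorted))
    (map-sorted tailθ (λ { (_ , refl) (_ , refl) → tailθ-mono }) lowStarts lowSorted)
    (All.tabulate λ x∈ → All.tabulate λ y∈ → cross x∈ y∈)
    where
    cross : ∀ {x y} → x ∈ map initθ high → y ∈ map tailθ low → x <ˡ y
    cross x∈ y∈
      with u , u∈ , refl ← ∈-map⁻ initθ x∈ | v , v∈ , refl ← ∈-map⁻ tailθ y∈
      with d , e , s , refl , _ ← highShape u∈ | b , c , r , refl , f ← lowShape v∈
      = initθ-high<tailθ-low b c r d e s f

  -- tailθ flips the first letter and initθ keeps it.
  lowStarts′ : All (StartsWith false) (nextLow low high)
  lowStarts′ = All.++⁺ (All.map⁺ (All.map (λ { (r , refl) → θ r , refl }) highStarts))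
                       (All.map⁺ (All.map (λ { (r , refl) → initθ-head false r }) lowStarts))

  highStarts′ : All (StartsWith true) (nextHigh low high)
  highStarts′ = All.++⁺ (All.map⁺ (All.map (λ { (r , refl) → initθ-head true r }) highStarts))
                        (All.map⁺ (All.map (λ { (r , refl) → θ r , refl }) lowStarts))

  Preimage : Word → Set
  Preimage w = ∃ λ u → u ∈ low ++ high × (w ≡ initθ u ⊎ w ≡ tailθ u)

  preimage : ∀ {xs w} (f : Word → Word) → (∀ {u} → w ≡ f u → w ≡ initθ u ⊎ w ≡ tailθ u) →
             (∀ {u} → u ∈ xs → u ∈ low ++ high) → w ∈ map f xs → Preimage w
  preimage f which incl w∈ with u , u∈ , w≡ ← ∈-map⁻ f w∈ = u , incl u∈ , which w≡

  blocks-sound : ∀ {w} → w ∈ nextLow low high ++ nextHigh low high → Preimage w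
  blocks-sound w∈ with ∈-++⁻ (nextLow low high) w∈
  ... | inj₁ p with ∈-++⁻ (map tailθ high) p
  ...   | inj₁ q = preimage tailθ inj₂ (∈-++⁺ʳ low) q
  ...   | inj₂ q = preimage initθ inj₁ ∈-++⁺ˡ q
  blocks-sound w∈ | inj₂ p with ∈-++⁻ (map initθ high) p
  ...   | inj₁ q = preimage initθ inj₁ (∈-++⁺ʳ low) q
  ...   | inj₂ q = preimage tailθ inj₂ ∈-++⁺ˡ q

  blocks-complete : ∀ {u} → u ∈ low ++ high →
    initθ u ∈ nextLow low high ++ nextHigh low high × tailθ u ∈ nextLow low high ++ nextHigh low high
  blocks-complete u∈ with ∈-++⁻ low u∈
  ... | inj₁ u∈low  = ∈-++⁺ˡ (∈-++⁺ʳ (map tailθ high) (∈-map⁺ initθ u∈low)) ,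
                      ∈-++⁺ʳ (nextLow low high) (∈-++⁺ʳ (map initθ high) (∈-map⁺ tailθ u∈low))
  ... | inj₂ u∈high = ∈-++⁺ʳ (nextLow low high) (∈-++⁺ˡ (∈-map⁺ initθ u∈high)) ,
                      ∈-++⁺ˡ (∈-++⁺ˡ (∈-map⁺ tailθ u∈high))

  members′ : ∀ w → w ∈ nextLow low high ++ nextHigh low high ⇔ InA (suc (suc k)) w
  members′ w = mk⇔ sound complete
    where
    sound : w ∈ nextLow low high ++ nextHigh low high → InA (suc (suc k)) w
    sound w∈ with blocks-sound w∈
    ... | u , u∈ , r with Equivalence.to (members u) u∈ | r
    ... | inA | inj₁ refl = proj₁ (𝒜-initθ-tailθ (suc k) inA)
    ... | inA | inj₂ refl = proj₂ (𝒜-initθ-tailθ (suc k) inA)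
    complete : InA (suc (suc k)) w → w ∈ nextLow low high ++ nextHigh low high
    complete inA with 𝒜-desubstitution (suc k) inA
    ... | u , inAu , r with blocks-complete (Equivalence.from (members u) inAu) | r
    ... | images | inj₁ refl = proj₁ images
    ... | images | inj₂ refl = proj₂ images

  balanced′ : length (nextLow low high) ≡ length (nextHigh low high)
  balanced′ = trans (length-images tailθ initθ) (sym (length-images initθ tailθ))
    where
    length-images : ∀ f g → length (map f high ++ map g low) ≡ length high + length low
    length-images f g = trans (length-++ (map f high)) (cong₂ _+_ (length-map f high) (length-map g low))

  next : Layer (suc (suc k)) (nextLow low high) (nextHigh low high)
  next = record
    { lowSorted = lowSorted′ ; highSorted = highSorted′
    ; lowStarts = lowStarts′ ; highStarts = highStarts′
    ; members = members′ ; balanced = balanced′ }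

module Base where
  pattern O = false
  pattern I = true

  low₁ high₁ : List Word
  low₁  = (O ∷ O ∷ I ∷ []) ∷ (O ∷ I ∷ O ∷ []) ∷ (O ∷ I ∷ I ∷ []) ∷ []
  high₁ = (I ∷ O ∷ O ∷ []) ∷ (I ∷ O ∷ I ∷ []) ∷ (I ∷ I ∷ O ∷ []) ∷ []

  -- Each listed word occurs in θ³(0) = 01101001.
  inθ³ : ∀ xs {a b c} ys → let w = a ∷ b ∷ c ∷ [] in tmPrefix 3 ≡ xs ++ w ++ ys → InA 1 w
  inθ³ xs ys e = refl , 3 , ⊑⇒infix (xs , ys , e)

  sound : ∀ {w} → w ∈ low₁ ++ high₁ → InA 1 w
  sound (here refl)                                         = inθ³ (O ∷ I ∷ I ∷ O ∷ I ∷ []) [] refl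
  sound (there (here refl))                                 = inθ³ (O ∷ I ∷ I ∷ []) (O ∷ I ∷ []) refl
  sound (there (there (here refl)))                         = inθ³ [] (O ∷ I ∷ O ∷ O ∷ I ∷ []) refl
  sound (there (there (there (here refl))))                 = inθ³ (O ∷ I ∷ I ∷ O ∷ []) (I ∷ []) refl
  sound (there (there (there (there (here refl)))))         = inθ³ (O ∷ I ∷ []) (O ∷ O ∷ I ∷ []) refl
  sound (there (there (there (there (there (here refl)))))) = inθ³ (O ∷ []) (I ∷ O ∷ O ∷ I ∷ []) refl

  -- The only other words of length 3 are the cubes.
  complete : ∀ {w} → InA 1 w → w ∈ low₁ ++ high₁
  complete {O ∷ O ∷ O ∷ []} (_ , f) = ⊥-elim (no-cube O f)
  complete {O ∷ O ∷ I ∷ []} _       = here refl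
  complete {O ∷ I ∷ O ∷ []} _       = there (here refl)
  complete {O ∷ I ∷ I ∷ []} _       = there (there (here refl))
  complete {I ∷ O ∷ O ∷ []} _       = there (there (there (here refl)))
  complete {I ∷ O ∷ I ∷ []} _       = there (there (there (there (here refl))))
  complete {I ∷ I ∷ O ∷ []} _       = there (there (there (there (there (here refl)))))
  complete {I ∷ I ∷ I ∷ []} (_ , f) = ⊥-elim (no-cube I f)
  complete {[]}                 (() , _)
  complete {_ ∷ []}             (() , _)
  complete {_ ∷ _ ∷ []}         (() , _)
  complete {_ ∷ _ ∷ _ ∷ _ ∷ _} (() , _)

  layer₁ : Layer 1 low₁ high₁
  layer₁ = record
    { lowSorted  = toWitness {a? = AllPairs.allPairs? _<ˡ?_ low₁} tt
    ; highSorted = toWitness {a? = AllPairs.allPairs? _<ˡ?_ high₁} tt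
    ; lowStarts  = (_ , refl) ∷ (_ , refl) ∷ (_ , refl) ∷ []
    ; highStarts = (_ , refl) ∷ (_ , refl) ∷ (_ , refl) ∷ []
    ; members    = λ w → mk⇔ sound complete
    ; balanced   = refl }

halves : ℕ → List Word × List Word
halves zero    = Base.low₁ , Base.high₁
halves (suc k) = nextLow (proj₁ (halves k)) (proj₂ (halves k)) ,
                 nextHigh (proj₁ (halves k)) (proj₂ (halves k))

layer : ∀ k → Layer (suc k) (proj₁ (halves k)) (proj₂ (halves k))
layer zero    = Base.layer₁
layer (suc k) = LayerStep.next (layer k)

InQuarter : List Word → ℕ → Word → Set
InQuarter L k w = Σ (Fin (length L)) λ j → lookup L j ≡ w ×
  (k ∸ 1) * length L < 4 * suc (toℕ j) × 4 * suc (toℕ j) ≤ k * length L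

-- Two enumerations of 𝒜_m coincide, so the quarters can be read off any one of them.
InQ-via : ∀ {m L} → Enumerates m L → ∀ k w → InQ m k w ⇔ InQuarter L k w
InQ-via {m} {L} (sortedL , membersL) k w = mk⇔ to (λ q → L , (sortedL , membersL) , q)
  where
  to : InQ m k w → InQuarter L k w
  to (l , (sortedl , membersl) , q) = subst (λ l → InQuarter l k w) l≡L q
    where
    l≡L : l ≡ L
    l≡L = sorted-unique <ˡ-trans <ˡ-irrefl
      (Linked⇒AllPairs <ˡ-trans sortedl) (Linked⇒AllPairs <ˡ-trans sortedL)
      (λ {u} u∈ → Equivalence.from (membersL u) (Equivalence.to (membersl u) u∈))
      (λ {u} u∈ → Equivalence.from (membersl u) (Equivalence.to (membersL u) u∈))

AtPositionIn : List Word → ℕ → ℕ → Word → Set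
AtPositionIn L a b w = Σ (Fin (length L)) λ j → lookup L j ≡ w × a ≤ toℕ j × toℕ j < b

quarter-bounds : ∀ c h x →
  (c * (4 * h) < 4 * suc x × 4 * suc x ≤ suc c * (4 * h)) ⇔ (c * h ≤ x × x < c * h + h)
quarter-bounds c h x = mk⇔
  (λ (lo , hi) → s≤s⁻¹ (*-cancelˡ-< 4 (c * h) (suc x) (subst (_< 4 * suc x) (scale c) lo)) ,
                 *-cancelˡ-≤ 4 (subst (4 * suc x ≤_) scale′ hi))
  (λ (lo , hi) → subst (_< 4 * suc x) (sym (scale c)) (*-monoʳ-< 4 (s≤s lo)) ,
                 subst (4 * suc x ≤_) (sym scale′) (*-monoʳ-≤ 4 hi))
  where
  scale : ∀ c → c * (4 * h) ≡ 4 * (c * h)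
  scale c = trans (sym (*-assoc c 4 h)) (trans (cong (_* h) (*-comm c 4)) (*-assoc 4 c h))
  scale′ : suc c * (4 * h) ≡ 4 * (c * h + h)
  scale′ = trans (scale (suc c)) (cong (4 *_) (+-comm h (c * h)))

quarter⇔range : ∀ {L h} c w → length L ≡ 4 * h →
                InQuarter L (suc c) w ⇔ AtPositionIn L (c * h) (c * h + h) w
quarter⇔range {L} {h} c w len = mk⇔
  (λ (j , e , bounds) → j , e ,
     Equivalence.to (quarter-bounds c h (toℕ j)) (subst (Bounds (toℕ j)) len bounds))
  (λ (j , e , range) → j , e ,
     subst (Bounds (toℕ j)) (sym len) (Equivalence.from (quarter-bounds c h (toℕ j)) range))
  where
  Bounds : ℕ → ℕ → Set
  Bounds x N = c * N < 4 * suc x × 4 * suc x ≤ suc c * N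

prefix-positions : ∀ Y Z w → AtPositionIn (Y ++ Z) 0 (length Y) w ⇔ w ∈ Y
prefix-positions []      Z w = mk⇔ (λ { (_ , _ , _ , ()) }) (λ ())
prefix-positions (y ∷ Y) Z w = mk⇔ to from
  where
  to : AtPositionIn (y ∷ Y ++ Z) 0 (suc (length Y)) w → w ∈ y ∷ Y
  to (zero  , e , _ , _)     = here (sym e)
  to (suc j , e , _ , s≤s q) = there (Equivalence.to (prefix-positions Y Z w) (j , e , z≤n , q))
  from : w ∈ y ∷ Y → AtPositionIn (y ∷ Y ++ Z) 0 (suc (length Y)) w
  from (here refl) = zero , refl , z≤n , s≤s z≤n
  from (there w∈) with j , e , _ , q ← Equivalence.from (prefix-positions Y Z w) w∈
    = suc j , e , z≤n , s≤s q

positions-∷ : ∀ x L a b w → AtPositionIn (x ∷ L) (suc a) (suc b) w ⇔ AtPositionIn L a b w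
positions-∷ x L a b w = mk⇔ (λ { (suc j , e , s≤s p , s≤s q) → j , e , p , q })
                            (λ (j , e , p , q) → suc j , e , s≤s p , s≤s q)

block-positions : ∀ X Y Z w → AtPositionIn (X ++ Y ++ Z) (length X) (length X + length Y) w ⇔ w ∈ Y
block-positions []      Y Z w = prefix-positions Y Z w
block-positions (x ∷ X) Y Z w =
  ⇔-trans (positions-∷ x (X ++ Y ++ Z) (length X) (length X + length Y) w) (block-positions X Y Z w)

record Quartered (m : ℕ) (A B C D : List Word) : Set where
  field
    first  : InQ m 1 ≐ (_∈ A)
    second : InQ m 2 ≐ (_∈ B)
    third  : InQ m 3 ≐ (_∈ C)
    fourth : InQ m 4 ≐ (_∈ D)

  lowerHalf : ∀ u → (InQ m 1 u ⊎ InQ m 2 u) ⇔ u ∈ A ++ B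
  lowerHalf u = ⇔-trans (first u ⊎-⇔ second u) (⇔-sym ++-∈⇔)

  upperHalf : ∀ u → (InQ m 3 u ⊎ InQ m 4 u) ⇔ u ∈ C ++ D
  upperHalf u = ⇔-trans (third u ⊎-⇔ fourth u) (⇔-sym ++-∈⇔)

quartered : ∀ {m} A B C D h → Enumerates m (A ++ B ++ C ++ D) →
            length A ≡ h → length B ≡ h → length C ≡ h → length D ≡ h → Quartered m A B C D
quartered {m} A B C D h enum lA lB lC lD = record
  { first  = block 0 [] A (B ++ C ++ D) refl refl lA
  ; second = block 1 A B (C ++ D) refl lA₁ lB
  ; third  = block 2 (A ++ B) C D (++-assoc A B (C ++ D)) lAB lC
  ; fourth = block 3 ((A ++ B) ++ C) D [] L≡ (grow (A ++ B) C 2 lAB lC) lD }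
  where
  L : List Word
  L = A ++ B ++ C ++ D

  grow : ∀ X Y c → length X ≡ c * h → length Y ≡ h → length (X ++ Y) ≡ suc c * h
  grow X Y c lX lY = trans (length-++ X) (trans (cong₂ _+_ lX lY) (+-comm (c * h) h))

  lA₁ : length A ≡ 1 * h
  lA₁ = trans lA (sym (+-identityʳ h))

  lAB : length (A ++ B) ≡ 2 * h
  lAB = grow A B 1 lA₁ lB

  L≡ : ((A ++ B) ++ C) ++ D ++ [] ≡ L
  L≡ = begin
    ((A ++ B) ++ C) ++ D ++ []   ≡⟨ cong (((A ++ B) ++ C) ++_) (++-identityʳ D) ⟩
    ((A ++ B) ++ C) ++ D         ≡⟨ ++-assoc (A ++ B) C D ⟩
    (A ++ B) ++ C ++ D           ≡⟨ ++-assoc A B (C ++ D) ⟩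
    L                            ∎
    where open ≡-Reasoning

  length-L : length L ≡ 4 * h
  length-L = trans (cong length (sym L≡))
    (trans (cong (λ Z → length (((A ++ B) ++ C) ++ Z)) (++-identityʳ D))
           (grow ((A ++ B) ++ C) D 3 (grow (A ++ B) C 2 lAB lC) lD))

  block : ∀ c X Y Z → X ++ Y ++ Z ≡ L → length X ≡ c * h → length Y ≡ h → InQ m (suc c) ≐ (_∈ Y)
  block c X Y Z L≡XYZ lX lY w =
    ⇔-trans (InQ-via {m} {L} enum (suc c) w)
    (⇔-trans (quarter⇔range {L} {h} c w length-L)
      (subst (λ l → AtPositionIn l (c * h) (c * h + h) w ⇔ w ∈ Y) L≡XYZ
        (subst₂ (λ a b → AtPositionIn (X ++ Y ++ Z) a b w ⇔ w ∈ Y) lX (cong₂ _+_ lX lY)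
                (block-positions X Y Z w))))

layer-quarters : ∀ k → let low = proj₁ (halves k) ; high = proj₂ (halves k) in
  Quartered (suc (suc k)) (map tailθ high) (map initθ low) (map initθ high) (map tailθ low)
layer-quarters k =
  quartered (map tailθ high) (map initθ low) (map initθ high) (map tailθ low) (length high)
    (subst (Enumerates (suc (suc k))) (++-assoc (map tailθ high) (map initθ low) (nextHigh low high))
           (Layer.enumerates (layer (suc k))))
    (length-map tailθ high) (trans (length-map initθ low) balanced)
    (length-map initθ high) (trans (length-map tailθ low) balanced)
  where
  low high : List Word
  low  = proj₁ (halves k)
  high = proj₂ (halves k)
  open Layer (layer k) using (balanced)

image-of-half : ∀ {R P Q : Word → Set} {Hs} (f g : Word → Word) →
                R ≐ (_∈ map g Hs) → (∀ u → (P u ⊎ Q u) ⇔ u ∈ Hs) →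
                (∀ {u} → u ∈ Hs → f u ≡ g u) → R ≐ ImageUnion f P Q
image-of-half {Hs = Hs} f g R≐ PQ≐ f≡g w = ⇔-trans (R≐ w) (mk⇔ to from)
  where
  to : w ∈ map g Hs → ImageUnion f _ _ w
  to w∈ with u , u∈ , w≡ ← ∈-map⁻ g w∈ = u , Equivalence.from (PQ≐ u) u∈ , trans (f≡g u∈) (sym w≡)
  from : ImageUnion f _ _ w → w ∈ map g Hs
  from (u , pq , refl) with u∈ ← Equivalence.to (PQ≐ u) pq = subst (_∈ map g Hs) (sym (f≡g u∈)) (∈-map⁺ g u∈)

proposition4 : ∀ (m : ℕ) → 2 ≤ m →
    (InQ (suc m) 1 ≐ ImageUnion (ε m) (InQ m 3) (InQ m 4))
    × (InQ (suc m) 2 ≐ ImageUnion (δ m) (InQ m 1) (InQ m 2))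
    × (InQ (suc m) 3 ≐ ImageUnion (δ m) (InQ m 3) (InQ m 4))
    × (InQ (suc m) 4 ≐ ImageUnion (ε m) (InQ m 1) (InQ m 2))
proposition4 zero          ()
proposition4 (suc zero)    (s≤s ())
proposition4 (suc (suc k)) _ =
    image-of-half (ε m) tailθ first  upperHalf (λ u∈ → ε≡tailθ m (∈-high u∈))
  , image-of-half (δ m) initθ second lowerHalf (λ u∈ → δ≡initθ m (∈-low u∈))
  , image-of-half (δ m) initθ third  upperHalf (λ u∈ → δ≡initθ m (∈-high u∈))
  , image-of-half (ε m) tailθ fourth lowerHalf (λ u∈ → ε≡tailθ m (∈-low u∈))
  where
  m : ℕ
  m = suc (suc k)
  open Layer (layer (suc k)) using (∈-low; ∈-high)
  open Quartered (layer-quarters k) using (lowerHalf; upperHalf)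
  open Quartered (layer-quarters (suc k)) using (first; second; third; fourth)
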